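{- Let $G$ be an $n$-vertex graph and $k$ a positive integer such that $\delta(G)\geq \max\{5k-3,\,n-k\}$. Let $\{s_1,t_1\},\ldots,\{s_r,t_r\}$, $r\leq k$, be pairs of vertices of $G$ (where $s_i=t_i$ is allowed) such that (i) $\{s_i,t_i\}\cap\{s_j,t_j\}=\emptyset$ for all $i\neq j$, $i,j\in\{1,\dots,r\}$, and (ii) there is at least one index $i\in\{1,\dots,r\}$ with $s_i\neq t_i$. Then there is a family of pairwise vertex-disjoint paths $P_1,\ldots,P_r$ in $G$ such that each $P_i$ is an $(s_i,t_i)$-path (a single vertex if $s_i=t_i$) and $\bigcup_{i=1}^r V(P_i)=V(G)$.
   Context: Graphs are finite, simple and undirected; $\delta(G)$ is the minimum vertex degree of $G$. An $(s,t)$-path is a simple path with end-vertices $s$ and $t$. -}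

module Defs where

open import Data.Nat using (ℕ; _≤_; _⊔_; _∸_; _*_)
open import Data.Fin using (Fin)
open import Data.Bool using (Bool; true; false; _≟_)
open import Data.List using (List; []; _∷_; length; filter; allFin)
open import Data.List.Relation.Unary.Unique.Propositional using (Unique)
open import Relation.Binary.PropositionalEquality using (_≡_)

record Graph (n : ℕ) : Set where
  field
    adj   : Fin n → Fin n → Bool
    sym   : ∀ u v → adj u v ≡ adj v u
    irref : ∀ v → adj v v ≡ false
open Graph public

degree : ∀ {n} → Graph n → Fin n → ℕ
degree G v = length (filter (λ w → adj G v w ≟ true) (allFin _))

minDegree≥ : ∀ {n} → Graph n → ℕ → Set
minDegree≥ G d = ∀ v → d ≤ degree G v

data Walk {n : ℕ} (G : Graph n) : Fin n → Fin n → Set where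
  here : ∀ v → Walk G v v
  step : ∀ {u v w} → adj G u v ≡ true → Walk G v w → Walk G u w

verts : ∀ {n} {G : Graph n} {u w} → Walk G u w → List (Fin n)
verts (here v) = v ∷ []
verts (step {u = u} _ p) = u ∷ verts p

record Path {n : ℕ} (G : Graph n) (s t : Fin n) : Set where
  field
    walk   : Walk G s t
    simple : Unique (verts walk)
open Path public

pathVerts : ∀ {n} {G : Graph n} {s t} → Path G s t → List (Fin n)
pathVerts P = verts (walk P)

-- Since δ ≥ n − k, every vertex has fewer than k non-neighbours, so any two vertices have a common
-- neighbour in every set of at least 2k − 1 other vertices. Hence each pair with s ≠ t can first be
-- joined through a private common neighbour (a pair with s = t gets a one-vertex path), as
-- n ≥ δ + 1 ≥ 5k − 2 leaves enough non-terminals. The remaining vertices are then absorbed one at a time,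
-- each inserted between two consecutive vertices of some path. While 2k − 1 vertices remain, one of
-- them is a common neighbour of the first edge of a path with s ≠ t. Otherwise take any remaining x:
-- if x fits into no path, its non-neighbours form a vertex cover of every path, so the paths have at
-- most 2(k − 1) + r vertices and n ≤ 2(k − 1) + r + (2k − 2) ≤ 5k − 4, contradicting n ≥ 5k − 2.

module Submission where

open import Defs hiding (sym)

open import Data.Empty using (⊥; ⊥-elim)
open import Data.Bool using (true; false; _≟_)
open import Data.Nat using (ℕ; zero; suc; _≤_; _<_; _+_; _*_; _∸_; _⊔_; z≤n; s≤s; _≤?_)
open import Data.Nat.Properties hiding (_≟_)
open import Data.Nat.Tactic.RingSolver using (solve-∀)
open import Data.Fin as F using (Fin)
import Data.Fin.Properties as Finₚ
open import Data.Product using (Σ; ∃; _×_; _,_; proj₁; proj₂)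
open import Data.Sum using (_⊎_; inj₁; inj₂; fromInj₂; map₂)
open import Data.List using (List; []; _∷_; length; filter; concat; _++_; allFin; tabulate)
open import Data.List.Properties using (length-++; filter-++; length-removeAt′; length-tabulate)
open import Data.List.Membership.Propositional using (_∈_; _∉_; find)
open import Data.List.Membership.Propositional.Properties
  using (∈-filter⁻; ∈-filter⁺; ∈-++⁻; ∈-++⁺ˡ; ∈-++⁺ʳ; ∈-allFin; ∈-concat⁻; ∈-concat⁺′; ∈-tabulate⁺)
open import Data.List.Relation.Unary.Any using (here; there; _─_; any?; index)
import Data.List.Relation.Unary.Any.Properties as Anyₚ
open import Data.List.Relation.Unary.All as All using (All; []; _∷_; lookup)
open import Data.List.Relation.Unary.All.Properties as Allₚ using (¬Any⇒All¬; All¬⇒¬Any; ─⁺; all-filter)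
import Data.List.Relation.Unary.AllPairs.Properties as AllPairsₚ
open import Data.List.Relation.Unary.Linked using (Linked; []; [-]; _∷_)
open import Data.List.Relation.Unary.Unique.Propositional using (Unique; []; _∷_)
open import Data.List.Relation.Unary.Unique.Propositional.Properties
  using (Unique[x∷xs]⇒x∉xs; ++⁺; filter⁺; allFin⁺; concat⁺)
open import Data.List.Relation.Binary.Subset.Propositional using (_⊆_)
open import Data.List.Relation.Binary.Disjoint.Propositional using (Disjoint)
open import Function using (id; _∘_)
open import Relation.Binary.PropositionalEquality using (_≡_; _≢_; refl; cong; cong₂; sym; trans; subst)
open import Relation.Nullary using (yes; no; ¬_; ¬?)
open import Relation.Nullary.Decidable using (_×-dec_; _⊎-dec_)
open import Relation.Unary using (Decidable)

module _ {A : Set} where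

  Unique-∷ : ∀ {x : A} {xs} → x ∉ xs → Unique xs → Unique (x ∷ xs)
  Unique-∷ {xs = xs} x∉xs xs! = ¬Any⇒All¬ xs x∉xs ∷ xs!

  ∈-─⁻ : ∀ {x v : A} {xs} (p : x ∈ xs) → v ∈ (xs ─ p) → v ∈ xs
  ∈-─⁻ (here _) q = there q
  ∈-─⁻ (there p) (here e) = here e
  ∈-─⁻ (there p) (there q) = there (∈-─⁻ p q)

  ∈-─⁺ : ∀ {x v : A} {xs} (p : x ∈ xs) → v ∈ xs → v ≡ x ⊎ v ∈ (xs ─ p)
  ∈-─⁺ (here refl) (here e) = inj₁ e
  ∈-─⁺ (here _) (there q) = inj₂ q
  ∈-─⁺ (there p) (here e) = inj₂ (here e)
  ∈-─⁺ (there p) (there q) = map₂ there (∈-─⁺ p q)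

  Unique-─ : ∀ {x : A} {xs} (p : x ∈ xs) → Unique xs → Unique (xs ─ p)
  Unique-─ (here _) (_ ∷ xs!) = xs!
  Unique-─ (there p) (y∉ ∷ xs!) = ─⁺ p y∉ ∷ Unique-─ p xs!

  ∉-─ : ∀ {x : A} {xs} (p : x ∈ xs) → Unique xs → x ∉ (xs ─ p)
  ∉-─ (here refl) xs! = Unique[x∷xs]⇒x∉xs xs!
  ∉-─ (there p) (y∉ ∷ _) (here refl) = All¬⇒¬Any y∉ p
  ∉-─ (there p) (_ ∷ xs!) (there q) = ∉-─ p xs! q

  Unique-⊆⇒length≤ : ∀ {xs ys : List A} → Unique xs → xs ⊆ ys → length xs ≤ length ys
  Unique-⊆⇒length≤ {[]} _ _ = z≤n
  Unique-⊆⇒length≤ {x ∷ xs} {ys} x∷xs!@(_ ∷ xs!) x∷xs⊆ys = begin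
    suc (length xs)        ≤⟨ s≤s (Unique-⊆⇒length≤ xs! xs⊆ys─x) ⟩
    suc (length (ys ─ x∈)) ≡⟨ length-removeAt′ ys (index x∈) ⟨
    length ys              ∎
    where
      open ≤-Reasoning
      x∈ = x∷xs⊆ys (here refl)
      xs⊆ys─x : xs ⊆ (ys ─ x∈)
      xs⊆ys─x v∈ with ∈-─⁺ x∈ (x∷xs⊆ys (there v∈))
      ... | inj₁ refl = ⊥-elim (Unique[x∷xs]⇒x∉xs x∷xs! v∈)
      ... | inj₂ q = q

  length≤length-filter+length-filter : ∀ {P Q : A → Set} (P? : Decidable P) (Q? : Decidable Q) xs →
    All (λ y → P y ⊎ Q y) xs → length xs ≤ length (filter P? xs) + length (filter Q? xs)
  length≤length-filter+length-filter P? Q? [] [] = z≤n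
  length≤length-filter+length-filter P? Q? (x ∷ xs) (Px⊎Qx ∷ PQxs)
    with ih ← length≤length-filter+length-filter P? Q? xs PQxs | P? x | Q? x | Px⊎Qx
  ... | yes _ | yes _  | _      = s≤s (≤-trans ih (+-monoʳ-≤ _ (n≤1+n _)))
  ... | yes _ | no _   | _      = s≤s ih
  ... | no _  | yes _  | _      = ≤-trans (s≤s ih) (≤-reflexive (sym (+-suc _ _)))
  ... | no ¬Px | no _  | inj₁ Px = ⊥-elim (¬Px Px)
  ... | no _  | no ¬Qx | inj₂ Qx = ⊥-elim (¬Qx Qx)

  IsVertexCover : (A → Set) → List A → Set
  IsVertexCover P = Linked (λ u v → P u ⊎ P v)

  module _ {P : A → Set} (P? : Decidable P) where

    vertexCover⇒length≤ : ∀ {xs} → IsVertexCover P xs → length xs ≤ suc (2 * length (filter P? xs))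
    vertexCover⇒length≤ [] = z≤n
    vertexCover⇒length≤ [-] = s≤s z≤n
    vertexCover⇒length≤ {x ∷ y ∷ _} (Px⊎Py ∷ cover) with P? x | cover
    ... | yes _ | _ = s≤s (≤-trans (vertexCover⇒length≤ cover) (≤-trans (n≤1+n _) (≤-reflexive (sym (*-suc 2 _)))))
    ... | no ¬Px | cover′ with P? y | Px⊎Py
    ...   | _      | inj₁ Px = ⊥-elim (¬Px Px)
    ...   | no ¬Py | inj₂ Py = ⊥-elim (¬Py Py)
    ...   | yes _  | inj₂ _ with cover′
    ...     | [-] = s≤s (s≤s z≤n)
    ...     | _ ∷ cover″ = s≤s (≤-trans (s≤s (vertexCover⇒length≤ cover″)) (≤-reflexive (sym (*-suc 2 _))))

    vertexCovers⇒length≤ : ∀ {xss} → All (IsVertexCover P) xss →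
      length (concat xss) ≤ 2 * length (filter P? (concat xss)) + length xss
    vertexCovers⇒length≤ [] = z≤n
    vertexCovers⇒length≤ {xs ∷ xss} (cover ∷ covers) = begin
      length (xs ++ concat xss)         ≡⟨ length-++ xs ⟩
      length xs + length (concat xss)   ≤⟨ +-mono-≤ (vertexCover⇒length≤ cover) (vertexCovers⇒length≤ covers) ⟩
      suc (2 * a) + (2 * b + length xss) ≡⟨ rearrange a b (length xss) ⟩
      2 * (a + b) + suc (length xss)     ≡⟨ cong (λ l → 2 * l + suc (length xss)) length-filter-++ ⟨
      2 * length (filter P? (xs ++ concat xss)) + suc (length xss) ∎
      where
        open ≤-Reasoning
        a = length (filter P? xs)
        b = length (filter P? (concat xss))
        rearrange : ∀ a b m → suc (2 * a) + (2 * b + m) ≡ 2 * (a + b) + suc m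
        rearrange = solve-∀
        length-filter-++ : length (filter P? (xs ++ concat xss)) ≡ a + b
        length-filter-++ = trans (cong length (filter-++ P? xs (concat xss))) (length-++ (filter P? xs))

∃⊎∀ : ∀ {m} {A B : Fin m → Set} → (∀ i → A i ⊎ B i) → (∃ A) ⊎ (∀ i → B i)
∃⊎∀ {zero} _ = inj₂ λ ()
∃⊎∀ {suc m} A⊎B with A⊎B F.zero | ∃⊎∀ (λ i → A⊎B (F.suc i))
... | inj₁ a | _            = inj₁ (F.zero , a)
... | inj₂ _ | inj₁ (i , a) = inj₁ (F.suc i , a)
... | inj₂ b | inj₂ bs      = inj₂ λ { F.zero → b ; (F.suc i) → bs i }

module _ {n : ℕ} (G : Graph n) where

  NonAdjacent : Fin n → Fin n → Set
  NonAdjacent x y = adj G x y ≡ false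

  nonAdjacent? : ∀ x → Decidable (NonAdjacent x)
  nonAdjacent? x y = adj G x y ≟ false

  nonNeighbours+degree<n : ∀ {x L} → Unique L → x ∉ L → All (NonAdjacent x) L →
                           length L + degree G x < n
  nonNeighbours+degree<n {x} {L} L! x∉L nonAdj = begin
    suc (length L + length N) ≡⟨ cong suc (length-++ L) ⟨
    length (x ∷ L ++ N)       ≤⟨ Unique-⊆⇒length≤ (Unique-∷ x∉L++N (++⁺ L! N! L∩N≡∅)) (λ {v} _ → ∈-allFin v) ⟩
    length (allFin n)         ≡⟨ length-tabulate _ ⟩
    n                         ∎
    where
      open ≤-Reasoning
      N = filter (λ w → adj G x w ≟ true) (allFin n)
      N! : Unique N
      N! = filter⁺ _ (allFin⁺ n)
      adjacent : ∀ {y} → y ∈ N → adj G x y ≡ true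
      adjacent y∈N = proj₂ (∈-filter⁻ (λ w → adj G x w ≟ true) {xs = allFin n} y∈N)
      L∩N≡∅ : ∀ {y} → y ∈ L × y ∈ N → ⊥
      L∩N≡∅ (y∈L , y∈N) with () ← trans (sym (lookup nonAdj y∈L)) (adjacent y∈N)
      x∉L++N : x ∉ L ++ N
      x∉L++N x∈ with ∈-++⁻ L x∈
      ... | inj₁ x∈L = x∉L x∈L
      ... | inj₂ x∈N with () ← trans (sym (irref G x)) (adjacent x∈N)

  degree<n : ∀ x → degree G x < n
  degree<n x = nonNeighbours+degree<n [] (λ ()) []

  head∈verts : ∀ {a b} (w : Walk G a b) → a ∈ verts w
  head∈verts (here _) = here refl
  head∈verts (step _ _) = here refl

  last∈verts : ∀ {a b} (w : Walk G a b) → b ∈ verts w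
  last∈verts (here _) = here refl
  last∈verts (step _ rest) = there (last∈verts rest)

  record Insertion {a b} (x : Fin n) (w : Walk G a b) : Set where
    field
      path : Path G a b
      ⊆x∷w : pathVerts path ⊆ x ∷ verts w
      x∷w⊆ : x ∷ verts w ⊆ pathVerts path

  insertBetween : ∀ {x u v b} (e : adj G u v ≡ true) (rest : Walk G v b) →
                  Unique (u ∷ verts rest) → x ∉ u ∷ verts rest →
                  adj G u x ≡ true → adj G x v ≡ true → Insertion x (step e rest)
  insertBetween {x} e rest (u∉rest ∷ rest!) x∉ ux xv = record
    { path = record { walk = step ux (step xv rest)
                    ; simple = Unique-∷ u∉x∷rest (Unique-∷ (λ x∈ → x∉ (there x∈)) rest!) }
    ; ⊆x∷w = swap
    ; x∷w⊆ = swap }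
    where
      u∉x∷rest : _ ∉ x ∷ verts rest
      u∉x∷rest (here refl) = x∉ (here refl)
      u∉x∷rest (there u∈) = All¬⇒¬Any u∉rest u∈
      swap : ∀ {p q} {xs : List (Fin n)} → p ∷ q ∷ xs ⊆ q ∷ p ∷ xs
      swap (here e) = there (here e)
      swap (there (here e)) = here e
      swap (there (there v∈)) = there (there v∈)

  insertion-∷ : ∀ {x u v b} (e : adj G u v ≡ true) {rest : Walk G v b} →
                Unique (u ∷ verts rest) → x ≢ u → Insertion x rest → Insertion x (step e rest)
  insertion-∷ e {rest} (u∉rest ∷ _) x≢u I = record
    { path = record { walk = step e (walk path) ; simple = Unique-∷ u∉path (simple path) }
    ; ⊆x∷w = λ { (here e) → there (here e) ; (there v∈) → lift (⊆x∷w v∈) }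
    ; x∷w⊆ = λ { (here e) → there (x∷w⊆ (here e)) ; (there (here e)) → here e
               ; (there (there v∈)) → there (x∷w⊆ (there v∈)) } }
    where
      open Insertion I
      lift : ∀ {v} → v ∈ _ ∷ verts rest → v ∈ _ ∷ _ ∷ verts rest
      lift (here e) = here e
      lift (there v∈) = there (there v∈)
      u∉path : _ ∉ pathVerts path
      u∉path u∈ with ⊆x∷w u∈
      ... | here u≡x = x≢u (sym u≡x)
      ... | there u∈rest = All¬⇒¬Any u∉rest u∈rest

  verts-∷ : ∀ {R : Fin n → Fin n → Set} {u v b} (rest : Walk G v b) →
            R u v → Linked R (verts rest) → Linked R (u ∷ verts rest)
  verts-∷ (here _) Ruv _ = Ruv ∷ [-]
  verts-∷ (step _ _) Ruv linked = Ruv ∷ linked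

  insertion-or-vertexCover : ∀ {a b} x (w : Walk G a b) → Unique (verts w) → x ∉ verts w →
                             Insertion x w ⊎ IsVertexCover (NonAdjacent x) (verts w)
  insertion-or-vertexCover x (here v) _ _ = inj₂ [-]
  insertion-or-vertexCover x (step {u} {v} e rest) w!@(_ ∷ rest!) x∉
    with insertion-or-vertexCover x rest rest! (λ x∈ → x∉ (there x∈))
  ... | inj₁ I = inj₁ (insertion-∷ e w! (λ x≡u → x∉ (here x≡u)) I)
  ... | inj₂ cover with adj G x u in xu | adj G x v in xv
  ...   | true  | true  = inj₁ (insertBetween e rest w! x∉ (trans (Graph.sym G u x) xu) xv)
  ...   | false | _     = inj₂ (verts-∷ rest (inj₁ xu) cover)
  ...   | true  | false = inj₂ (verts-∷ rest (inj₂ xv) cover)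

  record Connection (a b : Fin n) (U : List (Fin n)) : Set where
    field
      path     : Path G a b
      rest     : List (Fin n)
      rest!    : Unique rest
      rest⊆U   : rest ⊆ U
      U≤1+rest : length U ≤ suc (length rest)
      path⊆    : ∀ {v} → v ∈ pathVerts path → v ≡ a ⊎ v ≡ b ⊎ (v ∈ U × v ∉ rest)
      U⊆       : ∀ {v} → v ∈ U → v ∈ rest ⊎ v ∈ pathVerts path

  module _ {k : ℕ} (δ≥n∸k : minDegree≥ G (n ∸ k)) where

    nonNeighbours<k : ∀ {x L} → Unique L → x ∉ L → All (NonAdjacent x) L → length L < k
    nonNeighbours<k {x} {L} L! x∉L nonAdj = +-cancelʳ-≤ (n ∸ k) (suc (length L)) k (begin
      suc (length L) + (n ∸ k)   ≤⟨ +-monoʳ-≤ (suc (length L)) (δ≥n∸k x) ⟩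
      suc (length L + degree G x) ≤⟨ nonNeighbours+degree<n L! x∉L nonAdj ⟩
      n                          ≤⟨ m≤n+m∸n n k ⟩
      k + (n ∸ k)                ∎)
      where open ≤-Reasoning

    commonNeighbour : ∀ {a b U} → Unique U → a ∉ U → b ∉ U → k + k ≤ suc (length U) →
                      ∃ λ x → x ∈ U × adj G a x ≡ true × adj G x b ≡ true
    commonNeighbour {a} {b} {U} U! a∉U b∉U 2k≤1+U
      with any? (λ y → (adj G a y ≟ true) ×-dec (adj G y b ≟ true)) U
    ... | yes common = find common
    ... | no ¬common = ⊥-elim (<⇒≱ 2+U≤2k 2k≤1+U)
      where
        open ≤-Reasoning
        nonAdjacent-to-a-or-b : ∀ {y} → ¬ (adj G a y ≡ true × adj G y b ≡ true) →
                                NonAdjacent a y ⊎ NonAdjacent b y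
        nonAdjacent-to-a-or-b {y} ¬both with adj G a y | adj G b y | Graph.sym G y b
        ... | false | _     | _  = inj₁ refl
        ... | true  | false | _  = inj₂ refl
        ... | true  | true  | yb≡by = ⊥-elim (¬both (refl , yb≡by))
        nonNeighbours<k-in-U : ∀ c → c ∉ U → length (filter (nonAdjacent? c) U) < k
        nonNeighbours<k-in-U c c∉U = nonNeighbours<k (filter⁺ (nonAdjacent? c) U!)
          (λ c∈ → c∉U (proj₁ (∈-filter⁻ (nonAdjacent? c) {xs = U} c∈))) (all-filter (nonAdjacent? c) U)
        fa = length (filter (nonAdjacent? a) U)
        fb = length (filter (nonAdjacent? b) U)
        2+U≤2k : suc (suc (length U)) ≤ k + k
        2+U≤2k = begin
          suc (suc (length U)) ≤⟨ s≤s (s≤s (length≤length-filter+length-filter (nonAdjacent? a) (nonAdjacent? b) U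
                                     (All.map nonAdjacent-to-a-or-b (¬Any⇒All¬ U ¬common)))) ⟩
          suc (suc (fa + fb))  ≡⟨ cong suc (+-suc fa fb) ⟨
          suc fa + suc fb      ≤⟨ +-mono-≤ (nonNeighbours<k-in-U a a∉U) (nonNeighbours<k-in-U b b∉U) ⟩
          k + k                ∎

    insertionFromPool : ∀ {a b U} → a ≢ b → (w : Walk G a b) → Unique (verts w) → Unique U →
                        Disjoint U (verts w) → k + k ≤ suc (length U) → ∃ λ x → x ∈ U × Insertion x w
    insertionFromPool a≢b (here _) _ _ _ _ = ⊥-elim (a≢b refl)
    insertionFromPool a≢b (step e rest) w! U! U∩w≡∅ 2k≤1+U
      with x , x∈U , ax , xv ← commonNeighbour U! (λ a∈U → U∩w≡∅ (a∈U , here refl))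
                                 (λ v∈U → U∩w≡∅ (v∈U , there (head∈verts rest))) 2k≤1+U
      = x , x∈U , insertBetween e rest w! (λ x∈w → U∩w≡∅ (x∈U , x∈w)) ax xv

    connect : ∀ {a b U} → Unique U → a ∉ U → b ∉ U → k + k ≤ suc (length U) → Connection a b U
    connect {a} {b} {U} U! a∉U b∉U 2k≤1+U with a F.≟ b
    ... | yes refl = record
      { path = record { walk = here a ; simple = [] ∷ [] } ; rest = U ; rest! = U! ; rest⊆U = id
      ; U≤1+rest = n≤1+n _ ; path⊆ = λ { (here v≡a) → inj₁ v≡a } ; U⊆ = inj₁ }
    ... | no a≢b with c , c∈U , ac , cb ← commonNeighbour U! a∉U b∉U 2k≤1+U = record
      { path = record { walk = step ac (step cb (here b)) ; simple = a∉c∷b ∷ c∉b ∷ [] ∷ [] }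
      ; rest = U ─ c∈U
      ; rest! = Unique-─ c∈U U!
      ; rest⊆U = ∈-─⁻ c∈U
      ; U≤1+rest = ≤-reflexive (length-removeAt′ U (index c∈U))
      ; path⊆ = λ { (here v≡a) → inj₁ v≡a
                  ; (there (here refl)) → inj₂ (inj₂ (c∈U , ∉-─ c∈U U!))
                  ; (there (there (here v≡b))) → inj₂ (inj₁ v≡b) }
      ; U⊆ = U⊆rest∪path }
      where
        U⊆rest∪path : ∀ {v} → v ∈ U → v ∈ (U ─ c∈U) ⊎ v ∈ a ∷ c ∷ b ∷ []
        U⊆rest∪path v∈U with ∈-─⁺ c∈U v∈U
        ... | inj₁ refl = inj₂ (there (here refl))
        ... | inj₂ v∈rest = inj₁ v∈rest
        a∉c∷b : All (a ≢_) (c ∷ b ∷ [])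
        a∉c∷b = (λ { refl → a∉U c∈U }) ∷ a≢b ∷ []
        c∉b : All (c ≢_) (b ∷ [])
        c∉b = (λ { refl → b∉U c∈U }) ∷ []

DisjointPairs : ∀ {n r} → (s t : Fin r → Fin n) → Set
DisjointPairs s t = ∀ i j → i ≢ j → (s i ≢ s j) × (s i ≢ t j) × (t i ≢ s j) × (t i ≢ t j)

module Linkages {n : ℕ} (G : Graph n) {r : ℕ} (s t : Fin r → Fin n) where

  Linkage : Set
  Linkage = (i : Fin r) → Path G (s i) (t i)

  PairwiseDisjoint : Linkage → Set
  PairwiseDisjoint P = ∀ i j → i ≢ j → ∀ v → v ∈ pathVerts (P i) → v ∉ pathVerts (P j)

  record IsPartition (P : Linkage) (U : List (Fin n)) : Set where
    field
      disjoint : PairwiseDisjoint P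
      U!       : Unique U
      fresh    : ∀ i → Disjoint U (pathVerts (P i))
      covers   : ∀ v → v ∈ U ⊎ ∃ λ i → v ∈ pathVerts (P i)

  _[_≔_] : Linkage → (i : Fin r) → Path G (s i) (t i) → Linkage
  (P [ i ≔ Q ]) j with i F.≟ j
  ... | yes refl = Q
  ... | no _ = P j

  module _ (P : Linkage) (i : Fin r) (Q : Path G (s i) (t i)) where

    ∈-≔⁻ : ∀ j {v} → v ∈ pathVerts ((P [ i ≔ Q ]) j) →
           (i ≡ j × v ∈ pathVerts Q) ⊎ (i ≢ j × v ∈ pathVerts (P j))
    ∈-≔⁻ j v∈ with i F.≟ j
    ... | yes refl = inj₁ (refl , v∈)
    ... | no i≢j = inj₂ (i≢j , v∈)

    ∈-≔⁺-updated : ∀ {v} → v ∈ pathVerts Q → v ∈ pathVerts ((P [ i ≔ Q ]) i)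
    ∈-≔⁺-updated v∈ with i F.≟ i
    ... | yes refl = v∈
    ... | no i≢i = ⊥-elim (i≢i refl)

    ∈-≔⁺-other : ∀ {j v} → i ≢ j → v ∈ pathVerts (P j) → v ∈ pathVerts ((P [ i ≔ Q ]) j)
    ∈-≔⁺-other {j} i≢j v∈ with i F.≟ j
    ... | yes refl = ⊥-elim (i≢j refl)
    ... | no _ = v∈

  IsPartition-insert : ∀ {P U x} (part : IsPartition P U) (x∈U : x ∈ U) {i} (I : Insertion G x (walk (P i))) →
                       IsPartition (P [ i ≔ Insertion.path I ]) (U ─ x∈U)
  IsPartition-insert {P} {U} {x} part x∈U {i} I = record
    { disjoint = disjoint′ ; U! = Unique-─ x∈U U! ; fresh = fresh′ ; covers = covers′ }
    where
      open IsPartition part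
      open Insertion I
      P′ = P [ i ≔ path ]
      x∉rest : x ∉ (U ─ x∈U)
      x∉rest = ∉-─ x∈U U!
      onPath : ∀ {v} → v ∈ pathVerts path → v ≡ x ⊎ v ∈ pathVerts (P i)
      onPath v∈ with ⊆x∷w v∈
      ... | here v≡x = inj₁ v≡x
      ... | there v∈Pi = inj₂ v∈Pi
      new-vs-old : ∀ j → i ≢ j → ∀ v → v ∈ pathVerts path → v ∉ pathVerts (P j)
      new-vs-old j i≢j v v∈ v∈Pj with onPath v∈
      ... | inj₁ refl = fresh j (x∈U , v∈Pj)
      ... | inj₂ v∈Pi = disjoint i j i≢j v v∈Pi v∈Pj
      disjoint′ : PairwiseDisjoint P′
      disjoint′ j j′ j≢j′ v v∈ v∈′ with ∈-≔⁻ P i path j v∈ | ∈-≔⁻ P i path j′ v∈′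
      ... | inj₁ (refl , v∈Q) | inj₁ (refl , _)   = j≢j′ refl
      ... | inj₁ (refl , v∈Q) | inj₂ (i≢j′ , v∈Pj′) = new-vs-old j′ i≢j′ v v∈Q v∈Pj′
      ... | inj₂ (i≢j , v∈Pj) | inj₁ (refl , v∈Q)  = new-vs-old j i≢j v v∈Q v∈Pj
      ... | inj₂ (_ , v∈Pj)   | inj₂ (_ , v∈Pj′)   = disjoint j j′ j≢j′ v v∈Pj v∈Pj′
      fresh′ : ∀ j → Disjoint (U ─ x∈U) (pathVerts (P′ j))
      fresh′ j (v∈rest , v∈) with ∈-≔⁻ P i path j v∈
      ... | inj₂ (_ , v∈Pj) = fresh j (∈-─⁻ x∈U v∈rest , v∈Pj)
      ... | inj₁ (refl , v∈Q) with onPath v∈Q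
      ...   | inj₁ refl = x∉rest v∈rest
      ...   | inj₂ v∈Pi = fresh i (∈-─⁻ x∈U v∈rest , v∈Pi)
      covers′ : ∀ v → v ∈ (U ─ x∈U) ⊎ ∃ λ j → v ∈ pathVerts (P′ j)
      covers′ v with covers v
      ... | inj₁ v∈U with ∈-─⁺ x∈U v∈U
      ...   | inj₁ refl = inj₂ (i , ∈-≔⁺-updated P i path (x∷w⊆ (here refl)))
      ...   | inj₂ v∈rest = inj₁ v∈rest
      covers′ v | inj₂ (j , v∈Pj) with i F.≟ j
      ... | yes refl = inj₂ (i , ∈-≔⁺-updated P i path (x∷w⊆ (there v∈Pj)))
      ... | no i≢j = inj₂ (j , ∈-≔⁺-other P i path i≢j v∈Pj)

  CanExtend : Set
  CanExtend = ∀ {P U x} → IsPartition P U → x ∈ U → ∃ λ y → y ∈ U × ∃ λ i → Insertion G y (walk (P i))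

  complete : CanExtend → ∀ {P U} → IsPartition P U → ∃ λ (P′ : Linkage) → IsPartition P′ []
  complete canExtend {U = U} = go (length U) refl
    where
      go : ∀ m {P U} → length U ≡ m → IsPartition P U → ∃ λ (P′ : Linkage) → IsPartition P′ []
      go _ {U = []} _ part = _ , part
      go (suc m) {U = U@(_ ∷ _)} |U|≡1+m part with y , y∈U , i , I ← canExtend part (here refl) =
        go m (suc-injective (trans (sym (length-removeAt′ U (index y∈U))) |U|≡1+m)) (IsPartition-insert part y∈U I)

  linkageVerts : Linkage → List (Fin n)
  linkageVerts P = concat (tabulate (λ i → pathVerts (P i)))

  ∈-linkageVerts⁻ : ∀ {P v} → v ∈ linkageVerts P → ∃ λ i → v ∈ pathVerts (P i)
  ∈-linkageVerts⁻ {P} v∈ = Anyₚ.tabulate⁻ (∈-concat⁻ (tabulate (λ i → pathVerts (P i))) v∈)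

  Unique-linkageVerts : ∀ {P} → PairwiseDisjoint P → Unique (linkageVerts P)
  Unique-linkageVerts {P} disjoint = concat⁺ (Allₚ.tabulate⁺ (λ i → simple (P i)))
    (AllPairsₚ.tabulate⁺ (λ {i} {j} i≢j (v∈i , v∈j) → disjoint i j i≢j _ v∈i v∈j))

  n≤linkageVerts+U : ∀ {P U} → IsPartition P U → n ≤ length (linkageVerts P) + length U
  n≤linkageVerts+U {P} {U} part = begin
    n                                 ≡⟨ length-tabulate id ⟨
    length (allFin n)                 ≤⟨ Unique-⊆⇒length≤ (allFin⁺ n) allFin⊆ ⟩
    length (linkageVerts P ++ U)      ≡⟨ length-++ (linkageVerts P) ⟩
    length (linkageVerts P) + length U ∎
    where
      open ≤-Reasoning
      open IsPartition part
      allFin⊆ : allFin n ⊆ linkageVerts P ++ U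
      allFin⊆ {v} _ with covers v
      ... | inj₁ v∈U = ∈-++⁺ʳ (linkageVerts P) v∈U
      ... | inj₂ (i , v∈Pi) = ∈-++⁺ˡ (∈-concat⁺′ v∈Pi (∈-tabulate⁺ i))

  IsTerminal : Fin n → Set
  IsTerminal v = ∃ λ i → v ≡ s i ⊎ v ≡ t i

  isTerminal? : Decidable IsTerminal
  isTerminal? v = Finₚ.any? (λ i → (v F.≟ s i) ⊎-dec (v F.≟ t i))

  nonTerminals : List (Fin n)
  nonTerminals = filter (¬? ∘ isTerminal?) (allFin n)

  n≤r+r+nonTerminals : n ≤ r + (r + length nonTerminals)
  n≤r+r+nonTerminals = begin
    n                                           ≡⟨ length-tabulate id ⟨
    length (allFin n)                           ≤⟨ Unique-⊆⇒length≤ (allFin⁺ n) allFin⊆ ⟩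
    length (tabulate s ++ tabulate t ++ nonTerminals)
                                                ≡⟨ length-++ (tabulate s) ⟩
    r′ + length (tabulate t ++ nonTerminals)    ≡⟨ cong (r′ +_) (length-++ (tabulate t)) ⟩
    r′ + (length (tabulate t) + length nonTerminals)
                                                ≡⟨ cong₂ (λ a b → a + (b + length nonTerminals)) (length-tabulate s) (length-tabulate t) ⟩
    r + (r + length nonTerminals)               ∎
    where
      open ≤-Reasoning
      r′ = length (tabulate s)
      allFin⊆ : allFin n ⊆ tabulate s ++ tabulate t ++ nonTerminals
      allFin⊆ {v} _ with isTerminal? v
      ... | yes (i , inj₁ refl) = ∈-++⁺ˡ (∈-tabulate⁺ i)
      ... | yes (i , inj₂ refl) = ∈-++⁺ʳ (tabulate s) (∈-++⁺ˡ (∈-tabulate⁺ i))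
      ... | no ¬terminal = ∈-++⁺ʳ (tabulate s) (∈-++⁺ʳ (tabulate t) (∈-filter⁺ (¬? ∘ isTerminal?) (∈-allFin v) ¬terminal))

record InitialLinkage {n} (G : Graph n) {r} (s t : Fin r → Fin n) (U : List (Fin n)) : Set where
  open Linkages G s t using (Linkage; PairwiseDisjoint)
  field
    linkage  : Linkage
    rest     : List (Fin n)
    disjoint : PairwiseDisjoint linkage
    rest!    : Unique rest
    rest⊆U   : rest ⊆ U
    fresh    : ∀ i → Disjoint rest (pathVerts (linkage i))
    U⊆       : ∀ {v} → v ∈ U → v ∈ rest ⊎ ∃ λ i → v ∈ pathVerts (linkage i)
    inside   : ∀ i {v} → v ∈ pathVerts (linkage i) → v ≡ s i ⊎ v ≡ t i ⊎ v ∈ U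

module _ {n : ℕ} {G : Graph n} {k : ℕ} (δ≥n∸k : minDegree≥ G (n ∸ k)) where

  initialLinkage : ∀ {r} (s t : Fin r → Fin n) {U} → DisjointPairs s t → Unique U →
                   (∀ i → s i ∉ U × t i ∉ U) → k + k + r ≤ suc (suc (length U)) → InitialLinkage G s t U
  initialLinkage {zero} s t {U} _ U! _ _ = record
    { linkage = λ () ; rest = U ; disjoint = λ () ; rest! = U! ; rest⊆U = id
    ; fresh = λ () ; U⊆ = inj₁ ; inside = λ () }
  initialLinkage {suc r} s t {U} distinct U! outside bound = record
    { linkage = linkage ; rest = R.rest ; disjoint = disjoint ; rest! = R.rest!
    ; rest⊆U = λ v∈ → C.rest⊆U (R.rest⊆U v∈) ; fresh = fresh ; U⊆ = U⊆ ; inside = inside }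
    where
      s₀∉U = proj₁ (outside F.zero)
      t₀∉U = proj₂ (outside F.zero)
      k+k+r≤1+U : k + k + r ≤ suc (length U)
      k+k+r≤1+U = ≤-pred (subst (_≤ suc (suc (length U))) (+-suc (k + k) r) bound)
      C = connect G {k} δ≥n∸k U! s₀∉U t₀∉U (m+n≤o⇒m≤o (k + k) k+k+r≤1+U)
      module C = Connection C
      R = initialLinkage (λ i → s (F.suc i)) (λ i → t (F.suc i))
            (λ i j i≢j → distinct (F.suc i) (F.suc j) (λ e → i≢j (Finₚ.suc-injective e))) C.rest!
            (λ i → (λ s∈ → proj₁ (outside (F.suc i)) (C.rest⊆U s∈)) , (λ t∈ → proj₂ (outside (F.suc i)) (C.rest⊆U t∈)))
            (≤-trans k+k+r≤1+U (s≤s C.U≤1+rest))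
      module R = InitialLinkage R
      linkage : Linkages.Linkage G s t
      linkage F.zero = C.path
      linkage (F.suc i) = R.linkage i
      first-vs-later : ∀ j v → v ∈ pathVerts C.path → v ∉ pathVerts (R.linkage j)
      first-vs-later j v v∈C v∈R with C.path⊆ v∈C | R.inside j v∈R | distinct F.zero (F.suc j) (λ ())
      ... | inj₁ refl        | inj₁ e               | s≢s , _ = s≢s e
      ... | inj₁ refl        | inj₂ (inj₁ e)        | _ , s≢t , _ = s≢t e
      ... | inj₁ refl        | inj₂ (inj₂ v∈rest)   | _ = s₀∉U (C.rest⊆U v∈rest)
      ... | inj₂ (inj₁ refl) | inj₁ e               | _ , _ , t≢s , _ = t≢s e
      ... | inj₂ (inj₁ refl) | inj₂ (inj₁ e)        | _ , _ , _ , t≢t = t≢t e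
      ... | inj₂ (inj₁ refl) | inj₂ (inj₂ v∈rest)   | _ = t₀∉U (C.rest⊆U v∈rest)
      ... | inj₂ (inj₂ (v∈U , _)) | inj₁ refl       | _ = proj₁ (outside (F.suc j)) v∈U
      ... | inj₂ (inj₂ (v∈U , _)) | inj₂ (inj₁ refl) | _ = proj₂ (outside (F.suc j)) v∈U
      ... | inj₂ (inj₂ (_ , v∉rest)) | inj₂ (inj₂ v∈rest) | _ = v∉rest v∈rest
      disjoint : Linkages.PairwiseDisjoint G s t linkage
      disjoint F.zero F.zero 0≢0 = ⊥-elim (0≢0 refl)
      disjoint F.zero (F.suc j) _ = first-vs-later j
      disjoint (F.suc i) F.zero _ v v∈R v∈C = first-vs-later i v v∈C v∈R
      disjoint (F.suc i) (F.suc j) i≢j = R.disjoint i j (λ e → i≢j (cong F.suc e))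
      fresh : ∀ i → Disjoint R.rest (pathVerts (linkage i))
      fresh (F.suc i) = R.fresh i
      fresh F.zero (v∈rest , v∈C) with C.path⊆ v∈C
      ... | inj₁ refl = s₀∉U (C.rest⊆U (R.rest⊆U v∈rest))
      ... | inj₂ (inj₁ refl) = t₀∉U (C.rest⊆U (R.rest⊆U v∈rest))
      ... | inj₂ (inj₂ (_ , v∉rest)) = v∉rest (R.rest⊆U v∈rest)
      U⊆ : ∀ {v} → v ∈ U → v ∈ R.rest ⊎ ∃ λ i → v ∈ pathVerts (linkage i)
      U⊆ v∈U with C.U⊆ v∈U
      ... | inj₂ v∈C = inj₂ (F.zero , v∈C)
      ... | inj₁ v∈rest with R.U⊆ v∈rest
      ...   | inj₁ v∈rest′ = inj₁ v∈rest′
      ...   | inj₂ (i , v∈R) = inj₂ (F.suc i , v∈R)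
      inside : ∀ i {v} → v ∈ pathVerts (linkage i) → v ≡ s i ⊎ v ≡ t i ⊎ v ∈ U
      inside F.zero v∈ = map₂ (map₂ proj₁) (C.path⊆ v∈)
      inside (F.suc i) v∈ = map₂ (map₂ C.rest⊆U) (R.inside i v∈)

module _ {n : ℕ} {G : Graph n} {k : ℕ} (δ≥n∸k : minDegree≥ G (n ∸ k)) (5k≤n+2 : 5 * k ≤ n + 2)
         {r : ℕ} {s t : Fin r → Fin n} (r≤k : r ≤ k) where

  open Linkages G s t

  vertexCovers⇒n+4≤5k : ∀ {P U x} → IsPartition P U → x ∈ U → suc (suc (length U)) ≤ k + k →
    (∀ i → IsVertexCover (NonAdjacent G x) (pathVerts (P i))) → n + 4 ≤ 5 * k
  vertexCovers⇒n+4≤5k {P} {U} {x} part x∈U U+2≤2k vertexCovers = begin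
    n + 4                          ≤⟨ +-monoˡ-≤ 4 (n≤linkageVerts+U part) ⟩
    length W + length U + 4        ≤⟨ +-monoˡ-≤ 4 (+-monoˡ-≤ (length U) W≤2B+r) ⟩
    2 * length B + r + length U + 4 ≡⟨ rearrange (length B) r (length U) ⟩
    2 * suc (length B) + r + suc (suc (length U)) ≤⟨ +-mono-≤ (+-mono-≤ (*-monoʳ-≤ 2 B<k) r≤k) U+2≤2k ⟩
    2 * k + k + (k + k)            ≡⟨ five k ⟩
    5 * k                          ∎
    where
      open ≤-Reasoning
      open IsPartition part using (disjoint; fresh)
      W = linkageVerts P
      B = filter (nonAdjacent? G x) W
      W≤2B+r : length W ≤ 2 * length B + r
      W≤2B+r = subst (λ m → length W ≤ 2 * length B + m) (length-tabulate _)
                 (vertexCovers⇒length≤ (nonAdjacent? G x) (Allₚ.tabulate⁺ vertexCovers))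
      x∉B : x ∉ B
      x∉B x∈B with i , x∈Pi ← ∈-linkageVerts⁻ {P} (proj₁ (∈-filter⁻ (nonAdjacent? G x) {xs = W} x∈B)) =
        fresh i (x∈U , x∈Pi)
      B<k : length B < k
      B<k = nonNeighbours<k G δ≥n∸k (filter⁺ (nonAdjacent? G x) (Unique-linkageVerts {P} disjoint)) x∉B
              (all-filter (nonAdjacent? G x) W)
      rearrange : ∀ b r u → 2 * b + r + u + 4 ≡ 2 * suc b + r + suc (suc u)
      rearrange = solve-∀
      five : ∀ k → 2 * k + k + (k + k) ≡ 5 * k
      five = solve-∀

  module _ {i₀ : Fin r} (s≢t : s i₀ ≢ t i₀) where

    canExtend : CanExtend
    canExtend {P} {U} {x} part@record { U! = U! ; fresh = fresh } x∈U with k + k ≤? suc (length U)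
    ... | yes 2k≤1+U
      with y , y∈U , I ← insertionFromPool G {k} δ≥n∸k s≢t (walk (P i₀)) (simple (P i₀)) U! (fresh i₀) 2k≤1+U
      = y , y∈U , i₀ , I
    ... | no 2k≰1+U
      with ∃⊎∀ (λ i → insertion-or-vertexCover G x (walk (P i)) (simple (P i)) (λ x∈ → fresh i (x∈U , x∈)))
    ...   | inj₁ (i , I) = x , x∈U , i , I
    ...   | inj₂ vertexCovers
      with s≤s (s≤s ()) ← +-cancelˡ-≤ n 4 2 (≤-trans (vertexCovers⇒n+4≤5k part x∈U (≰⇒> 2k≰1+U) vertexCovers) 5k≤n+2)

  enoughNonTerminals : k + k + r ≤ suc (suc (length nonTerminals))
  enoughNonTerminals = +-cancelʳ-≤ (r + r) (k + k + r) (suc (suc u)) (begin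
    k + k + r + (r + r)   ≤⟨ +-mono-≤ (+-monoʳ-≤ (k + k) r≤k) (+-mono-≤ r≤k r≤k) ⟩
    k + k + k + (k + k)   ≡⟨ five k ⟩
    5 * k                 ≤⟨ 5k≤n+2 ⟩
    n + 2                 ≤⟨ +-monoˡ-≤ 2 n≤r+r+nonTerminals ⟩
    r + (r + u) + 2       ≡⟨ rearrange r u ⟩
    suc (suc u) + (r + r) ∎)
    where
      open ≤-Reasoning
      u = length nonTerminals
      five : ∀ k → k + k + k + (k + k) ≡ 5 * k
      five = solve-∀
      rearrange : ∀ r u → r + (r + u) + 2 ≡ suc (suc u) + (r + r)
      rearrange = solve-∀

  initialPartition : DisjointPairs s t → ∃ λ P → ∃ λ U → IsPartition P U
  initialPartition distinct = linkage , rest , record { disjoint = disjoint ; U! = rest! ; fresh = fresh ; covers = covers }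
    where
      terminal∉nonTerminals : ∀ {v} → IsTerminal v → v ∉ nonTerminals
      terminal∉nonTerminals terminal v∈ = proj₂ (∈-filter⁻ (¬? ∘ isTerminal?) {xs = allFin n} v∈) terminal
      open InitialLinkage (initialLinkage {k = k} δ≥n∸k s t distinct (filter⁺ (¬? ∘ isTerminal?) (allFin⁺ n))
             (λ i → terminal∉nonTerminals (i , inj₁ refl) , terminal∉nonTerminals (i , inj₂ refl)) enoughNonTerminals)
      covers : ∀ v → v ∈ rest ⊎ ∃ λ i → v ∈ pathVerts (linkage i)
      covers v with isTerminal? v
      ... | yes (i , inj₁ refl) = inj₂ (i , head∈verts G (walk (linkage i)))
      ... | yes (i , inj₂ refl) = inj₂ (i , last∈verts G (walk (linkage i)))
      ... | no ¬terminal = U⊆ (∈-filter⁺ (¬? ∘ isTerminal?) (∈-allFin v) ¬terminal)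

lemma1 : (n k : ℕ) (G : Graph n) → 1 ≤ k
    → minDegree≥ G ((5 * k ∸ 3) ⊔ (n ∸ k))
    → (r : ℕ) → r ≤ k → (s t : Fin r → Fin n)
    → (∀ i j → i ≢ j → (s i ≢ s j) × (s i ≢ t j) × (t i ≢ s j) × (t i ≢ t j))
    → (∃ λ i → s i ≢ t i)
    → Σ ((i : Fin r) → Path G (s i) (t i)) λ P →
        (∀ i j → i ≢ j → ∀ v → v ∈ pathVerts (P i) → v ∉ pathVerts (P j))
        × (∀ v → ∃ λ i → v ∈ pathVerts (P i))
lemma1 n k G _ δ≥ r r≤k s t distinct (i₀ , s≢t) =
  let _ , _ , part₀ = initialPartition δ≥n∸k 5k≤n+2 r≤k distinct
      P , part = complete (canExtend δ≥n∸k 5k≤n+2 r≤k s≢t) part₀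
  in P , IsPartition.disjoint part , λ v → fromInj₂ (λ ()) (IsPartition.covers part v)
  where
    open Linkages G s t
    open ≤-Reasoning
    δ≥n∸k : minDegree≥ G (n ∸ k)
    δ≥n∸k v = ≤-trans (m≤n⊔m (5 * k ∸ 3) (n ∸ k)) (δ≥ v)
    5k≤n+2 : 5 * k ≤ n + 2
    5k≤n+2 = begin
      5 * k                     ≤⟨ m≤n+m∸n (5 * k) 3 ⟩
      3 + (5 * k ∸ 3)           ≤⟨ +-monoʳ-≤ 3 (≤-trans (m≤m⊔n (5 * k ∸ 3) (n ∸ k)) (δ≥ (s i₀))) ⟩
      2 + suc (degree G (s i₀)) ≤⟨ +-monoʳ-≤ 2 (degree<n G (s i₀)) ⟩
      2 + n                     ≡⟨ +-comm 2 n ⟩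
      n + 2                     ∎
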